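{- Let $G$ be a forest with adjacency matrix $A$. Then $G$ is well-covered if and only if $\mathbf{e}^\top x$ is constant over $x\in\mathrm{SOL}(G)$. Moreover, if $G$ is well-covered and has no isolated vertices, then $\mathbf{e}^\top x=\frac{1}{2}|V(G)|$ for all $x\in\mathrm{SOL}(G)$.
   Context: $\mathrm{SOL}(G)$ is the set of $x$ with $x\ge0$, $(A+I)x\ge\mathbf{e}$, $x^\top((A+I)x-\mathbf{e})=0$ ($I$ identity, $\mathbf{e}$ all-ones vector). A graph is well-covered if all its maximal independent sets have the same cardinality. A forest is a disjoint union of trees.
   Formalization: The set $\mathrm{SOL}(G)$ is taken over vectors with rational entries. -}

module Defs where

open import Data.Nat using (ℕ; zero; suc)
open import Data.Fin using (Fin; zero; suc; inject₁; fromℕ)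
open import Data.Fin.Subset using (Subset; _∈_; _∉_; ∣_∣)
open import Data.Bool using (Bool; true; false; if_then_else_)
open import Data.Product using (Σ; ∃; _×_; _,_)
open import Data.Integer using (+_)
open import Data.Rational using (ℚ; 0ℚ; 1ℚ; _+_; _-_; _*_; _≤_; _/_)
open import Function.Definitions using (Injective)
open import Relation.Binary.PropositionalEquality using (_≡_)
open import Relation.Nullary using (¬_)

record Graph (n : ℕ) : Set where
  field
    adj    : Fin n → Fin n → Bool
    sym    : ∀ i j → adj i j ≡ adj j i
    irrefl : ∀ i → adj i i ≡ false
open Graph public

Σℚ : {n : ℕ} → (Fin n → ℚ) → ℚ
Σℚ {zero}  f = 0ℚ
Σℚ {suc n} f = f zero + Σℚ (λ i → f (suc i))

A : {n : ℕ} → Graph n → Fin n → Fin n → ℚ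
A G i j = if adj G i j then 1ℚ else 0ℚ

I : {n : ℕ} → Fin n → Fin n → ℚ
I {suc n} zero    zero    = 1ℚ
I {suc n} (suc i) (suc j) = I i j
I {suc n} zero    (suc j) = 0ℚ
I {suc n} (suc i) zero    = 0ℚ

[A+I]x : {n : ℕ} → Graph n → (Fin n → ℚ) → Fin n → ℚ
[A+I]x G x i = Σℚ (λ j → (A G i j + I i j) * x j)

eᵀ : {n : ℕ} → (Fin n → ℚ) → ℚ
eᵀ x = Σℚ x

SOL : {n : ℕ} → Graph n → (Fin n → ℚ) → Set
SOL G x = (∀ i → 0ℚ ≤ x i)
        × (∀ i → 1ℚ ≤ [A+I]x G x i)
        × (Σℚ (λ i → x i * ([A+I]x G x i - 1ℚ)) ≡ 0ℚ)

Independent : {n : ℕ} → Graph n → Subset n → Set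
Independent G S = ∀ i j → i ∈ S → j ∈ S → adj G i j ≡ false

MaximalIndependent : {n : ℕ} → Graph n → Subset n → Set
MaximalIndependent G S =
  Independent G S × (∀ v → v ∉ S → ∃ λ u → u ∈ S × adj G u v ≡ true)

WellCovered : {n : ℕ} → Graph n → Set
WellCovered G = ∀ S T → MaximalIndependent G S → MaximalIndependent G T → ∣ S ∣ ≡ ∣ T ∣

-- A cycle: k+3 ≥ 3 distinct vertices f 0, …, f (k+2), consecutive ones adjacent,
-- and the last adjacent to the first.
HasCycle : {n : ℕ} → Graph n → Set
HasCycle {n} G =
  Σ ℕ λ k → Σ (Fin (suc (suc (suc k))) → Fin n) λ f →
    Injective _≡_ _≡_ f
    × (∀ (i : Fin (suc (suc k))) → adj G (f (inject₁ i)) (f (suc i)) ≡ true)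
    × adj G (f (fromℕ (suc (suc k)))) (f zero) ≡ true

Forest : {n : ℕ} → Graph n → Set
Forest G = ¬ HasCycle G

NoIsolatedVertices : {n : ℕ} → Graph n → Set
NoIsolatedVertices G = ∀ v → ∃ λ u → adj G v u ≡ true

ConstantOnSOL : {n : ℕ} → Graph n → Set
ConstantOnSOL G = ∀ x y → SOL G x → SOL G y → eᵀ x ≡ eᵀ y

-- On a forest, well-coveredness forces the corona structure of Ravindra's theorem: every
-- vertex with two neighbours is adjacent to exactly one leaf. A well-covered graph never has
-- two leaves at one vertex, since one maximal independent set could then be traded for a
-- larger independent set. That a vertex with two neighbours has a leaf at all is proved on
-- induced subgraphs by induction: removing the pendant edge v₀v₁ at the end of a longest path
-- keeps the subgraph well-covered, and the property lifts back.
--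
-- So the pendant edges pair up all non-isolated vertices. For x ∈ SOL, complementarity forces
-- x v = 1 on isolated vertices and x u + x v = 1 across every pendant edge, whence
-- 2 eᵀx = |V| + #isolated. Conversely, the indicator vector of a maximal independent set lies
-- in SOL and its eᵀ-value is the size of the set.

module Submission where

open import Data.Bool using (Bool; true; false; if_then_else_)
import Data.Bool.Properties as Bool
open import Data.Empty using (⊥; ⊥-elim)
open import Data.Fin using (Fin; zero; suc; toℕ; inject₁; lower₁)
import Data.Fin.Properties as Fin
open import Data.Fin.Subset using (Subset; _∈_; _∉_; _⊆_; ∣_∣; ⁅_⁆; _∪_; _─_; ⊤; inside; outside)
  renaming (_-_ to _∖_; ⊥ to ∅)
open import Data.Fin.Subset.Properties
  using ( _∈?_; ∈⊤; ∉⊥; x∈⁅x⁆; x∈⁅y⁆⇒x≡y; p⊆p∪q; q⊆p∪q; x∈p∪q⁻; ∪-identityˡ; p─q⊆p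
        ; x∈p∧x∉q⇒x∈p─q; x∈p∧x≢y⇒x∈p-y; x∈p⇒∣p-x∣<∣p∣; p⊆q⇒∣p∣≤∣q∣; ∣p∣≤n )
open import Data.Integer using (+_)
import Data.Integer as ℤ
import Data.Integer.Solver as ℤ-Solver
open import Data.Nat using (ℕ; zero; suc; z≤n; s≤s)
import Data.Nat as ℕ
import Data.Nat.Induction as ℕ
import Data.Nat.Properties as ℕ
open import Data.Product using (_×_; _,_; ∃; proj₁; proj₂)
open import Data.Rational
  using (ℚ; 0ℚ; 1ℚ; _+_; _-_; _*_; _≤_; _<_; _/_; -_; toℚᵘ; positive; nonNegative)
import Data.Rational.Properties as ℚ
import Data.Rational.Solver as ℚ-Solver
import Data.Rational.Unnormalised as ℚᵘ
import Data.Rational.Unnormalised.Properties as ℚᵘ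
open import Algebra.Properties.CommutativeMonoid.Sum ℚ.+-0-commutativeMonoid
  using (sum; sum-cong-≗; ∑-distrib-+; ∑-comm)
open import Algebra.Properties.Group ℚ.+-0-group using () renaming (∙-cancelˡ to +-cancelˡ)
open import Data.Sum using (_⊎_; inj₁; inj₂; [_,_]′)
open import Data.Vec using ([]; _∷_; here; there; lookup; tabulate)
import Data.Vec.Functional as Vector
open import Data.Vec.Properties using (lookup⇒[]=; []=⇒lookup; lookup∘tabulate)
open import Function using (_∘_; id)
open import Function.Definitions using (Injective)
open import Induction.WellFounded using (module All)
import Relation.Binary.Construct.On as On
open import Relation.Binary.Definitions using (tri<; tri≈; tri>)
open import Relation.Binary.PropositionalEquality
open import Relation.Nullary using (¬_; Dec; yes; no)
open import Relation.Nullary.Decidable using (_×-dec_; _⊎-dec_; _→-dec_; ¬?; decidable-stable)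

open import Defs hiding (sym)

0≤1 : 0ℚ ≤ 1ℚ
0≤1 = ℚ.<⇒≤ (ℚ.positive⁻¹ 1ℚ)

1≤p⇒0<p : ∀ {p} → 1ℚ ≤ p → 0ℚ < p
1≤p⇒0<p = ℚ.<-≤-trans (ℚ.positive⁻¹ 1ℚ)

p≤p+q : ∀ {p q} → 0ℚ ≤ q → p ≤ p + q
p≤p+q {p} {q} 0≤q = subst (_≤ p + q) (ℚ.+-identityʳ p) (ℚ.+-monoʳ-≤ p 0≤q)

p≤q+p : ∀ {p q} → 0ℚ ≤ q → p ≤ q + p
p≤q+p {p} {q} 0≤q = subst (_≤ q + p) (ℚ.+-identityˡ p) (ℚ.+-monoˡ-≤ p 0≤q)

+-nonNeg : ∀ {p q} → 0ℚ ≤ p → 0ℚ ≤ q → 0ℚ ≤ p + q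
+-nonNeg 0≤p 0≤q = ℚ.≤-trans 0≤p (p≤p+q 0≤q)

*-nonNeg : ∀ {p q} → 0ℚ ≤ p → 0ℚ ≤ q → 0ℚ ≤ p * q
*-nonNeg {p} {q} 0≤p 0≤q =
  subst (_≤ p * q) (ℚ.*-zeroʳ p) (ℚ.*-monoˡ-≤-nonNeg p {{nonNegative 0≤p}} 0≤q)

*-pos : ∀ {p q} → 0ℚ < p → 0ℚ < q → 0ℚ < p * q
*-pos {p} {q} 0<p 0<q =
  subst (_< p * q) (ℚ.*-zeroʳ p) (ℚ.*-monoʳ-<-pos p {{positive 0<p}} 0<q)

1≤p⇒0≤p-1 : ∀ {p} → 1ℚ ≤ p → 0ℚ ≤ p - 1ℚ
1≤p⇒0≤p-1 {p} 1≤p = subst (_≤ p - 1ℚ) (ℚ.+-inverseʳ 1ℚ) (ℚ.+-monoˡ-≤ (- 1ℚ) 1≤p)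

p-1≡0⇒p≡1 : ∀ {p} → p - 1ℚ ≡ 0ℚ → p ≡ 1ℚ
p-1≡0⇒p≡1 {p} p-1≡0 = begin
  p              ≡⟨ solve 1 (λ p → p := (p :- con 1ℚ) :+ con 1ℚ) refl p ⟩
  (p - 1ℚ) + 1ℚ  ≡⟨ cong (_+ 1ℚ) p-1≡0 ⟩
  0ℚ + 1ℚ        ≡⟨ ℚ.+-identityˡ 1ℚ ⟩
  1ℚ             ∎
  where open ≡-Reasoning; open ℚ-Solver.+-*-Solver

slack-vanishes : ∀ {x r} → 0ℚ < x → 1ℚ ≤ r → x * (r - 1ℚ) ≡ 0ℚ → r ≡ 1ℚ
slack-vanishes {x} {r} 0<x 1≤r x[r-1]≡0 with ℚ.<-cmp 0ℚ (r - 1ℚ)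
... | tri< 0<r-1 _ _ = ⊥-elim (ℚ.<-irrefl (sym x[r-1]≡0) (*-pos 0<x 0<r-1))
... | tri≈ _ 0≡r-1 _ = p-1≡0⇒p≡1 (sym 0≡r-1)
... | tri> _ _ r-1<0 = ⊥-elim (ℚ.<-irrefl refl (ℚ.<-≤-trans r-1<0 (1≤p⇒0≤p-1 1≤r)))

0≤p⇒p≡0⊎0<p : ∀ {p} → 0ℚ ≤ p → p ≡ 0ℚ ⊎ 0ℚ < p
0≤p⇒p≡0⊎0<p {p} 0≤p with ℚ.<-cmp 0ℚ p
... | tri< 0<p _ _ = inj₂ 0<p
... | tri≈ _ 0≡p _ = inj₁ (sym 0≡p)
... | tri> _ _ p<0 = ⊥-elim (ℚ.<-irrefl refl (ℚ.<-≤-trans p<0 0≤p))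

p+p≡q+q⇒p≡q : ∀ {p q} → p + p ≡ q + q → p ≡ q
p+p≡q+q⇒p≡q {p} {q} eq with ℚ.<-cmp p q
... | tri< p<q _ _ = ⊥-elim (ℚ.<-irrefl eq (ℚ.+-mono-< p<q p<q))
... | tri≈ _ p≡q _ = p≡q
... | tri> _ _ q<p = ⊥-elim (ℚ.<-irrefl (sym eq) (ℚ.+-mono-< q<p q<p))

fromℕ : ℕ → ℚ
fromℕ zero    = 0ℚ
fromℕ (suc m) = 1ℚ + fromℕ m

fromℕ-nonNeg : ∀ m → 0ℚ ≤ fromℕ m
fromℕ-nonNeg zero    = ℚ.≤-refl
fromℕ-nonNeg (suc m) = +-nonNeg 0≤1 (fromℕ-nonNeg m)

fromℕ-injective : ∀ {m m′} → fromℕ m ≡ fromℕ m′ → m ≡ m′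
fromℕ-injective {zero}  {zero}   eq = refl
fromℕ-injective {zero}  {suc m′} eq = ⊥-elim (ℚ.<-irrefl eq (1≤p⇒0<p (p≤p+q (fromℕ-nonNeg m′))))
fromℕ-injective {suc m} {zero}   eq = ⊥-elim (ℚ.<-irrefl (sym eq) (1≤p⇒0<p (p≤p+q (fromℕ-nonNeg m))))
fromℕ-injective {suc m} {suc m′} eq = cong suc (fromℕ-injective (+-cancelˡ 1ℚ _ _ eq))

fromℕ≃m/1 : ∀ m → toℚᵘ (fromℕ m) ℚᵘ.≃ ℚᵘ.mkℚᵘ (+ m) 0
fromℕ≃m/1 zero    = ℚᵘ.≃-refl
fromℕ≃m/1 (suc m) = ℚᵘ.≃-trans (ℚ.toℚᵘ-homo-+ 1ℚ (fromℕ m))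
  (ℚᵘ.≃-trans (ℚᵘ.+-congʳ (toℚᵘ 1ℚ) (fromℕ≃m/1 m)) (ℚᵘ.*≡* (lemma (+ m))))
  where
  open ℤ-Solver.+-*-Solver
  lemma : ∀ z → (+ 1 ℤ.* + 1 ℤ.+ z ℤ.* + 1) ℤ.* + 1 ≡ (+ 1 ℤ.+ z) ℤ.* (+ 1 ℤ.* + 1)
  lemma = solve 1 (λ z → (con (+ 1) :* con (+ 1) :+ z :* con (+ 1)) :* con (+ 1)
                      := (con (+ 1) :+ z) :* (con (+ 1) :* con (+ 1))) refl

m/2+m/2≡fromℕ : ∀ m → (+ m) / 2 + (+ m) / 2 ≡ fromℕ m
m/2+m/2≡fromℕ m = ℚ.toℚᵘ-injective (ℚᵘ.≃-trans (ℚ.toℚᵘ-homo-+ half half)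
  (ℚᵘ.≃-trans (ℚᵘ.+-cong (ℚ.toℚᵘ-fromℚᵘ m/2) (ℚ.toℚᵘ-fromℚᵘ m/2))
  (ℚᵘ.≃-trans (ℚᵘ.*≡* (lemma (+ m))) (ℚᵘ.≃-sym (fromℕ≃m/1 m)))))
  where
  half : ℚ
  half = (+ m) / 2
  m/2 : ℚᵘ.ℚᵘ
  m/2 = ℚᵘ.mkℚᵘ (+ m) 1
  open ℤ-Solver.+-*-Solver
  lemma : ∀ z → (z ℤ.* + 2 ℤ.+ z ℤ.* + 2) ℤ.* + 1 ≡ z ℤ.* (+ 2 ℤ.* + 2)
  lemma = solve 1 (λ z → (z :* con (+ 2) :+ z :* con (+ 2)) :* con (+ 1)
                      := z :* (con (+ 2) :* con (+ 2))) refl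

Σℚ≡sum : ∀ {n} (f : Fin n → ℚ) → Σℚ f ≡ sum f
Σℚ≡sum {zero}  f = refl
Σℚ≡sum {suc n} f = cong (_+_ (f zero)) (Σℚ≡sum (λ i → f (suc i)))

Σℚ-cong : ∀ {n} {f g : Fin n → ℚ} → (∀ i → f i ≡ g i) → Σℚ f ≡ Σℚ g
Σℚ-cong {f = f} {g} f≗g = trans (Σℚ≡sum f) (trans (sum-cong-≗ f≗g) (sym (Σℚ≡sum g)))

Σℚ-distrib-+ : ∀ {n} (f g : Fin n → ℚ) → Σℚ (λ i → f i + g i) ≡ Σℚ f + Σℚ g
Σℚ-distrib-+ f g = begin
  Σℚ (λ i → f i + g i)  ≡⟨ Σℚ≡sum (λ i → f i + g i) ⟩
  sum (λ i → f i + g i) ≡⟨ ∑-distrib-+ f g ⟩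
  sum f + sum g         ≡⟨ sym (cong₂ _+_ (Σℚ≡sum f) (Σℚ≡sum g)) ⟩
  Σℚ f + Σℚ g           ∎
  where open ≡-Reasoning

Σℚ-comm : ∀ {m n} (f : Fin m → Fin n → ℚ) →
          Σℚ (λ i → Σℚ (λ j → f i j)) ≡ Σℚ (λ j → Σℚ (λ i → f i j))
Σℚ-comm f = begin
  Σℚ (λ i → Σℚ (λ j → f i j))   ≡⟨ Σℚ-cong (λ i → Σℚ≡sum (f i)) ⟩
  Σℚ (λ i → sum (λ j → f i j))  ≡⟨ Σℚ≡sum (λ i → sum (λ j → f i j)) ⟩
  sum (λ i → sum (λ j → f i j)) ≡⟨ ∑-comm f ⟩
  sum (λ j → sum (λ i → f i j)) ≡⟨ sym (Σℚ≡sum (λ j → sum (λ i → f i j))) ⟩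
  Σℚ (λ j → sum (λ i → f i j))  ≡⟨ sym (Σℚ-cong (λ j → Σℚ≡sum (λ i → f i j))) ⟩
  Σℚ (λ j → Σℚ (λ i → f i j))   ∎
  where open ≡-Reasoning

Σℚ-zero : ∀ {n} (f : Fin n → ℚ) → (∀ i → f i ≡ 0ℚ) → Σℚ f ≡ 0ℚ
Σℚ-zero {zero}  f f≡0 = refl
Σℚ-zero {suc n} f f≡0 =
  trans (cong₂ _+_ (f≡0 zero) (Σℚ-zero _ (λ i → f≡0 (suc i)))) (ℚ.+-identityˡ 0ℚ)

Σℚ-single : ∀ {n} (f : Fin n → ℚ) i → (∀ j → j ≢ i → f j ≡ 0ℚ) → Σℚ f ≡ f i
Σℚ-single f zero    others≡0 =
  trans (cong (_+_ (f zero)) (Σℚ-zero _ (λ j → others≡0 (suc j) (λ ())))) (ℚ.+-identityʳ _)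
Σℚ-single f (suc i) others≡0 =
  trans (cong (_+ Σℚ (λ j → f (suc j))) (others≡0 zero (λ ())))
  (trans (ℚ.+-identityˡ _)
         (Σℚ-single (λ j → f (suc j)) i (λ j j≢i → others≡0 (suc j) (j≢i ∘ Fin.suc-injective))))

Σℚ-nonNeg : ∀ {n} (f : Fin n → ℚ) → (∀ i → 0ℚ ≤ f i) → 0ℚ ≤ Σℚ f
Σℚ-nonNeg {zero}  f f≥0 = ℚ.≤-refl
Σℚ-nonNeg {suc n} f f≥0 = +-nonNeg (f≥0 zero) (Σℚ-nonNeg _ (λ i → f≥0 (suc i)))

Σℚ-term≤ : ∀ {n} (f : Fin n → ℚ) → (∀ i → 0ℚ ≤ f i) → ∀ i → f i ≤ Σℚ f
Σℚ-term≤ f f≥0 zero    = p≤p+q (Σℚ-nonNeg _ (λ i → f≥0 (suc i)))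
Σℚ-term≤ f f≥0 (suc i) = ℚ.≤-trans (Σℚ-term≤ _ (λ i → f≥0 (suc i)) i) (p≤q+p (f≥0 zero))

Σℚ≡0⇒term≡0 : ∀ {n} (f : Fin n → ℚ) → (∀ i → 0ℚ ≤ f i) → Σℚ f ≡ 0ℚ → ∀ i → f i ≡ 0ℚ
Σℚ≡0⇒term≡0 f f≥0 Σf≡0 i = ℚ.≤-antisym (subst (f i ≤_) Σf≡0 (Σℚ-term≤ f f≥0 i)) (f≥0 i)

Σℚ-I : ∀ {n} i (g : Fin n → ℚ) → Σℚ (λ j → I i j * g j) ≡ g i
Σℚ-I zero    g = trans (cong₂ _+_ (ℚ.*-identityˡ (g zero)) (Σℚ-zero _ (λ j → ℚ.*-zeroˡ (g (suc j)))))
                       (ℚ.+-identityʳ _)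
Σℚ-I (suc i) g = trans (cong (_+ Σℚ (λ j → I i j * g (suc j))) (ℚ.*-zeroˡ (g zero)))
                       (trans (ℚ.+-identityˡ _) (Σℚ-I i (λ j → g (suc j))))

Σℚ-one : ∀ n → Σℚ {n} (λ _ → 1ℚ) ≡ fromℕ n
Σℚ-one zero    = refl
Σℚ-one (suc n) = cong (_+_ 1ℚ) (Σℚ-one n)

module _ {n : ℕ} (G : Graph n) where

  adj-sym : ∀ {u v} → adj G u v ≡ true → adj G v u ≡ true
  adj-sym {u} {v} = trans (Graph.sym G v u)

  nonadj-sym : ∀ {u v} → adj G u v ≡ false → adj G v u ≡ false
  nonadj-sym {u} {v} = trans (Graph.sym G v u)

  adj⇒≢ : ∀ {u v} → adj G u v ≡ true → u ≢ v
  adj⇒≢ {u} uv refl with trans (sym uv) (irrefl G u)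
  ... | ()

  Isolated : Fin n → Set
  Isolated v = ∀ u → adj G v u ≡ false

  isolated⇒¬adj : ∀ {v u} → Isolated v → adj G v u ≢ true
  isolated⇒¬adj {v} {u} iso vu with trans (sym (iso u)) vu
  ... | ()

  PendantAt : Fin n → Fin n → Set
  PendantAt v a = adj G v a ≡ true × (∀ u → adj G v u ≡ true → u ≡ a)

  A-nonNeg : ∀ u v → 0ℚ ≤ A G u v
  A-nonNeg u v with adj G u v
  ... | true  = 0≤1
  ... | false = ℚ.≤-refl

  A*-adj : ∀ {u v} → adj G u v ≡ true → ∀ y → A G u v * y ≡ y
  A*-adj uv y rewrite uv = ℚ.*-identityˡ y

  A*-nonadj : ∀ {u v} → adj G u v ≡ false → ∀ y → A G u v * y ≡ 0ℚ
  A*-nonadj uv y rewrite uv = ℚ.*-zeroˡ y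

  neighbourSum : (Fin n → ℚ) → Fin n → ℚ
  neighbourSum x v = Σℚ (λ u → A G v u * x u)

  neighbourSum-nonNeg : ∀ {x} → (∀ u → 0ℚ ≤ x u) → ∀ v → 0ℚ ≤ neighbourSum x v
  neighbourSum-nonNeg x≥0 v = Σℚ-nonNeg _ (λ u → *-nonNeg (A-nonNeg v u) (x≥0 u))

  neighbourSum-isolated : ∀ x {v} → Isolated v → neighbourSum x v ≡ 0ℚ
  neighbourSum-isolated x iso = Σℚ-zero _ (λ u → A*-nonadj (iso u) (x u))

  neighbourSum-pendant : ∀ x {v a} → PendantAt v a → neighbourSum x v ≡ x a
  neighbourSum-pendant x {v} {a} (va , only-a) =
    trans (Σℚ-single _ a (λ u u≢a → A*-nonadj (nonadj u u≢a) (x u))) (A*-adj va (x a))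
    where
    nonadj : ∀ u → u ≢ a → adj G v u ≡ false
    nonadj u u≢a with adj G v u in vu
    ... | true  = ⊥-elim (u≢a (only-a u vu))
    ... | false = refl

  [A+I]x≡x+neighbourSum : ∀ x v → [A+I]x G x v ≡ x v + neighbourSum x v
  [A+I]x≡x+neighbourSum x v = begin
    Σℚ (λ u → (A G v u + I v u) * x u)
      ≡⟨ Σℚ-cong (λ u → ℚ.*-distribʳ-+ (x u) (A G v u) (I v u)) ⟩
    Σℚ (λ u → A G v u * x u + I v u * x u)
      ≡⟨ Σℚ-distrib-+ (λ u → A G v u * x u) (λ u → I v u * x u) ⟩
    neighbourSum x v + Σℚ (λ u → I v u * x u)
      ≡⟨ cong (_+_ (neighbourSum x v)) (Σℚ-I v x) ⟩
    neighbourSum x v + x v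
      ≡⟨ ℚ.+-comm (neighbourSum x v) (x v) ⟩
    x v + neighbourSum x v
      ∎
    where open ≡-Reasoning

  module _ {x : Fin n → ℚ} (x∈SOL : SOL G x) where

    private
      x≥0 : ∀ v → 0ℚ ≤ x v
      x≥0 = proj₁ x∈SOL

      feasible : ∀ v → 1ℚ ≤ [A+I]x G x v
      feasible = proj₁ (proj₂ x∈SOL)

      slack≡0 : ∀ v → x v * ([A+I]x G x v - 1ℚ) ≡ 0ℚ
      slack≡0 = Σℚ≡0⇒term≡0 _ (λ v → *-nonNeg (x≥0 v) (1≤p⇒0≤p-1 (feasible v))) (proj₂ (proj₂ x∈SOL))

      tight : ∀ v → 0ℚ < x v → [A+I]x G x v ≡ 1ℚ
      tight v 0<xv = slack-vanishes 0<xv (feasible v) (slack≡0 v)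

      x≤[A+I]x : ∀ v → x v ≤ [A+I]x G x v
      x≤[A+I]x v = subst (x v ≤_) (sym ([A+I]x≡x+neighbourSum x v)) (p≤p+q (neighbourSum-nonNeg x≥0 v))

      1≤x⇒x≡1 : ∀ v → 1ℚ ≤ x v → x v ≡ 1ℚ
      1≤x⇒x≡1 v 1≤xv = ℚ.≤-antisym (subst (x v ≤_) (tight v (1≤p⇒0<p 1≤xv)) (x≤[A+I]x v)) 1≤xv

    SOL-isolated : ∀ {v} → Isolated v → x v ≡ 1ℚ
    SOL-isolated {v} iso = 1≤x⇒x≡1 v (subst (1ℚ ≤_) row≡xv (feasible v))
      where
      open ≡-Reasoning
      row≡xv : [A+I]x G x v ≡ x v
      row≡xv = begin
        [A+I]x G x v           ≡⟨ [A+I]x≡x+neighbourSum x v ⟩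
        x v + neighbourSum x v ≡⟨ cong (_+_ (x v)) (neighbourSum-isolated x iso) ⟩
        x v + 0ℚ               ≡⟨ ℚ.+-identityʳ (x v) ⟩
        x v                   ∎

    SOL-pendant : ∀ {v a} → PendantAt v a → x v + x a ≡ 1ℚ
    SOL-pendant {v} {a} v-a with 0≤p⇒p≡0⊎0<p (x≥0 v)
    ... | inj₂ 0<xv = trans (sym row≡xv+xa) (tight v 0<xv)
      where
      row≡xv+xa : [A+I]x G x v ≡ x v + x a
      row≡xv+xa = trans ([A+I]x≡x+neighbourSum x v) (cong (_+_ (x v)) (neighbourSum-pendant x v-a))
    ... | inj₁ xv≡0 = begin
      x v + x a ≡⟨ cong₂ _+_ xv≡0 xa≡1 ⟩
      0ℚ + 1ℚ   ≡⟨ ℚ.+-identityˡ 1ℚ ⟩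
      1ℚ        ∎
      where
      open ≡-Reasoning
      row≡xa : [A+I]x G x v ≡ x a
      row≡xa = trans ([A+I]x≡x+neighbourSum x v)
        (trans (cong₂ _+_ xv≡0 (neighbourSum-pendant x v-a)) (ℚ.+-identityˡ (x a)))
      xa≡1 : x a ≡ 1ℚ
      xa≡1 = 1≤x⇒x≡1 a (subst (1ℚ ≤_) row≡xa (feasible v))

indicator : ∀ {n} → Subset n → Fin n → ℚ
indicator S i = if lookup S i then 1ℚ else 0ℚ

indicator-∈ : ∀ {n} {S : Subset n} {i} → i ∈ S → indicator S i ≡ 1ℚ
indicator-∈ i∈S rewrite []=⇒lookup i∈S = refl

indicator-∉ : ∀ {n} {S : Subset n} {i} → i ∉ S → indicator S i ≡ 0ℚ
indicator-∉ {S = S} {i} i∉S with lookup S i in Si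
... | true  = ⊥-elim (i∉S (lookup⇒[]= i S Si))
... | false = refl

indicator-nonNeg : ∀ {n} (S : Subset n) i → 0ℚ ≤ indicator S i
indicator-nonNeg S i with lookup S i
... | true  = 0≤1
... | false = ℚ.≤-refl

Σℚ-indicator : ∀ {n} (S : Subset n) → Σℚ (indicator S) ≡ fromℕ ∣ S ∣
Σℚ-indicator []          = refl
Σℚ-indicator (true ∷ S)  = cong (_+_ 1ℚ) (Σℚ-indicator S)
Σℚ-indicator (false ∷ S) = trans (ℚ.+-identityˡ _) (Σℚ-indicator S)

module _ {n : ℕ} (G : Graph n) {S : Subset n} (S-max : MaximalIndependent G S) where

  private
    x : Fin n → ℚ
    x = indicator S

    neighbourSum-∈ : ∀ {v} → v ∈ S → neighbourSum G x v ≡ 0ℚ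
    neighbourSum-∈ {v} v∈S = Σℚ-zero _ term≡0
      where
      term≡0 : ∀ u → A G v u * x u ≡ 0ℚ
      term≡0 u with u ∈? S
      ... | yes u∈S = A*-nonadj G (proj₁ S-max v u v∈S u∈S) (x u)
      ... | no  u∉S = trans (cong (_*_ (A G v u)) (indicator-∉ u∉S)) (ℚ.*-zeroʳ (A G v u))

    1≤neighbourSum-∉ : ∀ {v} → v ∉ S → 1ℚ ≤ neighbourSum G x v
    1≤neighbourSum-∉ {v} v∉S with proj₂ S-max v v∉S
    ... | u , u∈S , uv = subst (_≤ neighbourSum G x v)
      (trans (A*-adj G (adj-sym G uv) (x u)) (indicator-∈ u∈S))
      (Σℚ-term≤ _ (λ w → *-nonNeg (A-nonNeg G v w) (indicator-nonNeg S w)) u)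

    row : ∀ v → [A+I]x G x v ≡ x v + neighbourSum G x v
    row = [A+I]x≡x+neighbourSum G x

    feasible : ∀ v → 1ℚ ≤ [A+I]x G x v
    feasible v with v ∈? S
    ... | yes v∈S = subst (1ℚ ≤_) (sym (trans (row v) (cong (_+ neighbourSum G x v) (indicator-∈ v∈S))))
                      (p≤p+q (neighbourSum-nonNeg G (indicator-nonNeg S) v))
    ... | no  v∉S = subst (1ℚ ≤_) (sym row≡neighbourSum) (1≤neighbourSum-∉ v∉S)
      where
      row≡neighbourSum : [A+I]x G x v ≡ neighbourSum G x v
      row≡neighbourSum = trans (row v) (trans (cong (_+ neighbourSum G x v) (indicator-∉ v∉S)) (ℚ.+-identityˡ _))

    slack≡0 : ∀ v → x v * ([A+I]x G x v - 1ℚ) ≡ 0ℚ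
    slack≡0 v with v ∈? S
    ... | no  v∉S = trans (cong (_* slack) (indicator-∉ v∉S)) (ℚ.*-zeroˡ slack)
      where
      slack : ℚ
      slack = [A+I]x G x v - 1ℚ
    ... | yes v∈S = begin
      x v * ([A+I]x G x v - 1ℚ) ≡⟨ cong₂ (λ a r → a * (r - 1ℚ)) (indicator-∈ v∈S) row≡1 ⟩
      1ℚ * (1ℚ - 1ℚ)            ≡⟨ cong (_*_ 1ℚ) (ℚ.+-inverseʳ 1ℚ) ⟩
      1ℚ * 0ℚ                   ≡⟨ ℚ.*-zeroʳ 1ℚ ⟩
      0ℚ                        ∎
      where
      open ≡-Reasoning
      row≡1 : [A+I]x G x v ≡ 1ℚ
      row≡1 = trans (row v) (trans (cong₂ _+_ (indicator-∈ v∈S) (neighbourSum-∈ v∈S)) (ℚ.+-identityʳ 1ℚ))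

  maximalIndependent⇒indicator∈SOL : SOL G (indicator S)
  maximalIndependent⇒indicator∈SOL = indicator-nonNeg S , feasible , Σℚ-zero _ slack≡0

constantOnSOL⇒wellCovered : ∀ {n} (G : Graph n) → ConstantOnSOL G → WellCovered G
constantOnSOL⇒wellCovered G constant S T S-max T-max = fromℕ-injective (begin
  fromℕ ∣ S ∣       ≡⟨ sym (Σℚ-indicator S) ⟩
  eᵀ (indicator S)  ≡⟨ constant _ _ (maximalIndependent⇒indicator∈SOL G S-max)
                                    (maximalIndependent⇒indicator∈SOL G T-max) ⟩
  eᵀ (indicator T)  ≡⟨ Σℚ-indicator T ⟩
  fromℕ ∣ T ∣       ∎)
  where open ≡-Reasoning

𝟙 : ∀ {p} {P : Set p} → Dec P → ℚ
𝟙 (yes _) = 1ℚ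
𝟙 (no _)  = 0ℚ

𝟙*-yes : ∀ {p} {P : Set p} (P? : Dec P) → P → ∀ y → 𝟙 P? * y ≡ y
𝟙*-yes (yes _) _ y = ℚ.*-identityˡ y
𝟙*-yes (no ¬p) p y = ⊥-elim (¬p p)

𝟙-no : ∀ {p} {P : Set p} (P? : Dec P) → ¬ P → 𝟙 P? ≡ 0ℚ
𝟙-no (yes p) ¬p = ⊥-elim (¬p p)
𝟙-no (no _)  _  = refl

𝟙*-no : ∀ {p} {P : Set p} (P? : Dec P) → ¬ P → ∀ y → 𝟙 P? * y ≡ 0ℚ
𝟙*-no P? ¬p y = trans (cong (_* y) (𝟙-no P? ¬p)) (ℚ.*-zeroˡ y)

𝟙-cong : ∀ {p q} {P : Set p} {Q : Set q} (P? : Dec P) (Q? : Dec Q) → (P → Q) → (Q → P) → 𝟙 P? ≡ 𝟙 Q?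
𝟙-cong (yes _) (yes _) _   _   = refl
𝟙-cong (no _)  (no _)  _   _   = refl
𝟙-cong (yes p) (no ¬q) p⇒q _   = ⊥-elim (¬q (p⇒q p))
𝟙-cong (no ¬p) (yes q) _   q⇒p = ⊥-elim (¬p (q⇒p q))

module _ {n : ℕ} (G : Graph n) where

  Leaf : Fin n → Set
  Leaf v = ∃ (PendantAt G v)

  leaf? : ∀ v → Dec (Leaf v)
  leaf? v = Fin.any? (λ a → (adj G v a Bool.≟ true)
                      ×-dec Fin.all? (λ u → (adj G v u Bool.≟ true) →-dec (u Fin.≟ a)))

  isolated? : ∀ v → Dec (Isolated G v)
  isolated? v = Fin.all? (λ u → adj G v u Bool.≟ false)

  PendantEdge : Fin n → Fin n → Set
  PendantEdge v u = adj G v u ≡ true × (Leaf v ⊎ Leaf u)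

  pendantEdge? : ∀ v u → Dec (PendantEdge v u)
  pendantEdge? v u = (adj G v u Bool.≟ true) ×-dec (leaf? v ⊎-dec leaf? u)

  PendantEdge-sym : ∀ {v u} → PendantEdge v u → PendantEdge u v
  PendantEdge-sym (vu , inj₁ v-leaf) = adj-sym G vu , inj₂ v-leaf
  PendantEdge-sym (vu , inj₂ u-leaf) = adj-sym G vu , inj₁ u-leaf

  PendantEdge⇒PendantAt : ∀ {v u} → PendantEdge v u → PendantAt G v u ⊎ PendantAt G u v
  PendantEdge⇒PendantAt {v} {u} (vu , inj₁ (a , va , only-a)) with only-a u vu
  ... | refl = inj₁ (va , only-a)
  PendantEdge⇒PendantAt {v} {u} (vu , inj₂ (a , ua , only-a)) with only-a v (adj-sym G vu)
  ... | refl = inj₂ (ua , only-a)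

  PendantEdge-isolated : ∀ {v u} → Isolated G v → ¬ PendantEdge v u
  PendantEdge-isolated iso (vu , _) = isolated⇒¬adj G iso vu

  Σℚ-isolated≡0 : NoIsolatedVertices G → Σℚ (λ v → 𝟙 (isolated? v)) ≡ 0ℚ
  Σℚ-isolated≡0 no-isolated =
    Σℚ-zero _ (λ v → 𝟙-no (isolated? v) (λ iso → isolated⇒¬adj G iso (proj₂ (no-isolated v))))

  PendantMatching : Set
  PendantMatching = ∀ v → ¬ Isolated G v → ∃ λ u → PendantEdge v u × (∀ w → PendantEdge v w → w ≡ u)

  Σℚ-matched : PendantMatching → (y : Fin n → ℚ) → ∀ {v} → ¬ Isolated G v →
               ∃ λ u → PendantEdge v u × Σℚ (λ w → 𝟙 (pendantEdge? v w) * y w) ≡ y u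
  Σℚ-matched matching y {v} ¬iso with matching v ¬iso
  ... | u , vu , unique = u , vu ,
    trans (Σℚ-single _ u (λ w w≢u → 𝟙*-no (pendantEdge? v w) (w≢u ∘ unique w) (y w)))
          (𝟙*-yes (pendantEdge? v u) vu (y u))

  Σℚ-unmatched : (y : Fin n → ℚ) → ∀ {v} → Isolated G v → Σℚ (λ w → 𝟙 (pendantEdge? v w) * y w) ≡ 0ℚ
  Σℚ-unmatched y iso = Σℚ-zero _ (λ w → 𝟙*-no (pendantEdge? _ w) (PendantEdge-isolated iso) (y w))

  -- Double counting x over the symmetric pendant-edge relation.
  module _ (matching : PendantMatching) {x : Fin n → ℚ} (x∈SOL : SOL G x) where

    private
      own partner isolated : Fin n → ℚ
      own      v = Σℚ (λ u → 𝟙 (pendantEdge? v u) * x v)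
      partner  v = Σℚ (λ u → 𝟙 (pendantEdge? v u) * x u)
      isolated v = 𝟙 (isolated? v)

      x≡own+isolated : ∀ v → x v ≡ own v + isolated v
      x≡own+isolated v with isolated? v
      ... | yes iso = sym (trans (cong₂ _+_ (Σℚ-unmatched (λ _ → x v) iso) (sym (SOL-isolated G x∈SOL iso)))
                                 (ℚ.+-identityˡ (x v)))
      ... | no ¬iso with Σℚ-matched matching (λ _ → x v) ¬iso
      ... | _ , _ , own≡xv = sym (trans (cong (_+ 0ℚ) own≡xv) (ℚ.+-identityʳ (x v)))

      own+partner+isolated≡1 : ∀ v → own v + partner v + isolated v ≡ 1ℚ
      own+partner+isolated≡1 v with isolated? v
      ... | yes iso = trans (cong (_+ 1ℚ) (trans (cong₂ _+_ (Σℚ-unmatched (λ _ → x v) iso) (Σℚ-unmatched x iso))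
                                                 (ℚ.+-identityˡ 0ℚ)))
                            (ℚ.+-identityˡ 1ℚ)
      ... | no ¬iso with Σℚ-matched matching (λ _ → x v) ¬iso | Σℚ-matched matching x ¬iso
      ... | _ , _ , own≡xv | u , vu , partner≡xu =
        trans (ℚ.+-identityʳ _) (trans (cong₂ _+_ own≡xv partner≡xu) (pendant-pair (PendantEdge⇒PendantAt vu)))
        where
        pendant-pair : PendantAt G v u ⊎ PendantAt G u v → x v + x u ≡ 1ℚ
        pendant-pair (inj₁ v-u) = SOL-pendant G x∈SOL v-u
        pendant-pair (inj₂ u-v) = trans (ℚ.+-comm (x v) (x u)) (SOL-pendant G x∈SOL u-v)

      Σown≡Σpartner : Σℚ own ≡ Σℚ partner
      Σown≡Σpartner = trans (Σℚ-comm (λ v u → 𝟙 (pendantEdge? v u) * x v))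
        (Σℚ-cong (λ u → Σℚ-cong (λ v → cong (_* x v)
          (𝟙-cong (pendantEdge? v u) (pendantEdge? u v) PendantEdge-sym PendantEdge-sym))))

    SOL-double-sum : eᵀ x + eᵀ x ≡ fromℕ n + Σℚ (λ v → 𝟙 (isolated? v))
    SOL-double-sum = begin
      eᵀ x + eᵀ x
        ≡⟨ cong₂ _+_ eᵀx≡Σown+Σi (trans eᵀx≡Σown+Σi (cong (_+ Σi) Σown≡Σpartner)) ⟩
      (Σℚ own + Σi) + (Σℚ partner + Σi)
        ≡⟨ solve 3 (λ a b c → (a :+ c) :+ (b :+ c) := ((a :+ b) :+ c) :+ c) refl (Σℚ own) (Σℚ partner) Σi ⟩
      ((Σℚ own + Σℚ partner) + Σi) + Σi
        ≡⟨ cong (_+ Σi) (sym (trans (Σℚ-distrib-+ _ isolated) (cong (_+ Σi) (Σℚ-distrib-+ own partner)))) ⟩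
      Σℚ (λ v → own v + partner v + isolated v) + Σi
        ≡⟨ cong (_+ Σi) (trans (Σℚ-cong own+partner+isolated≡1) (Σℚ-one n)) ⟩
      fromℕ n + Σi
        ∎
      where
      open ≡-Reasoning
      open ℚ-Solver.+-*-Solver
      Σi : ℚ
      Σi = Σℚ isolated
      eᵀx≡Σown+Σi : eᵀ x ≡ Σℚ own + Σi
      eᵀx≡Σown+Σi = trans (Σℚ-cong x≡own+isolated) (Σℚ-distrib-+ own isolated)

x∈p─q⁻ : ∀ {n} {x : Fin n} (p q : Subset n) → x ∈ p ─ q → x ∈ p × x ∉ q
x∈p─q⁻ (s ∷ p) (outside ∷ q) here        = here , λ ()
x∈p─q⁻ (s ∷ p) (t ∷ q)       (there x∈) with x∈p─q⁻ p q x∈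
... | x∈p , x∉q = there x∈p , λ { (there x∈q) → x∉q x∈q }

x∈p∖y⁻ : ∀ {n} {x y : Fin n} {p : Subset n} → x ∈ p ∖ y → x ∈ p × x ≢ y
x∈p∖y⁻ {y = y} {p} x∈ with x∈p─q⁻ p ⁅ y ⁆ x∈
... | x∈p , x∉⁅y⁆ = x∈p , λ { refl → x∉⁅y⁆ (x∈⁅x⁆ y) }

x∈⁅x⁆∪p : ∀ {n} (x : Fin n) (p : Subset n) → x ∈ ⁅ x ⁆ ∪ p
x∈⁅x⁆∪p x p = p⊆p∪q p (x∈⁅x⁆ x)

y∈⁅x⁆∪p⁻ : ∀ {n} {x y : Fin n} {p : Subset n} → y ∈ ⁅ x ⁆ ∪ p → y ≡ x ⊎ y ∈ p
y∈⁅x⁆∪p⁻ {x = x} {p = p} y∈ with x∈p∪q⁻ ⁅ x ⁆ p y∈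
... | inj₁ y∈⁅x⁆ = inj₁ (x∈⁅y⁆⇒x≡y x y∈⁅x⁆)
... | inj₂ y∈p   = inj₂ y∈p

∣⁅x⁆∪p∣≡1+∣p∣ : ∀ {n} {x : Fin n} {p : Subset n} → x ∉ p → ∣ ⁅ x ⁆ ∪ p ∣ ≡ suc ∣ p ∣
∣⁅x⁆∪p∣≡1+∣p∣ {x = zero}  {outside ∷ p} x∉p = cong (suc ∘ ∣_∣) (∪-identityˡ p)
∣⁅x⁆∪p∣≡1+∣p∣ {x = zero}  {inside ∷ p}  x∉p = ⊥-elim (x∉p here)
∣⁅x⁆∪p∣≡1+∣p∣ {x = suc x} {inside ∷ p}  x∉p = cong suc (∣⁅x⁆∪p∣≡1+∣p∣ (x∉p ∘ there))
∣⁅x⁆∪p∣≡1+∣p∣ {x = suc x} {outside ∷ p} x∉p = ∣⁅x⁆∪p∣≡1+∣p∣ (x∉p ∘ there)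

∷-injective : ∀ {a} {A : Set a} {m u} {f : Fin m → A} → (∀ i → f i ≢ u) → Injective _≡_ _≡_ f →
              Injective _≡_ _≡_ (u Vector.∷ f)
∷-injective u∉f f-inj {zero}  {zero}  _  = refl
∷-injective u∉f f-inj {zero}  {suc j} eq = ⊥-elim (u∉f j (sym eq))
∷-injective u∉f f-inj {suc i} {zero}  eq = ⊥-elim (u∉f i eq)
∷-injective u∉f f-inj {suc i} {suc j} eq = cong suc (f-inj eq)

tail-injective : ∀ {a} {A : Set a} {m} {f : Fin (suc m) → A} → Injective _≡_ _≡_ f →
                 Injective _≡_ _≡_ (Vector.tail f)
tail-injective f-inj = Fin.suc-injective ∘ f-inj

module _ {n : ℕ} (G : Graph n) where

  IndependentIn : Subset n → Subset n → Set
  IndependentIn W S = S ⊆ W × (∀ u v → u ∈ S → v ∈ S → adj G u v ≡ false)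

  DominatingIn : Subset n → Subset n → Set
  DominatingIn W S = ∀ v → v ∈ W → v ∉ S → ∃ λ u → u ∈ S × adj G u v ≡ true

  MaximalIndependentIn : Subset n → Subset n → Set
  MaximalIndependentIn W S = IndependentIn W S × DominatingIn W S

  WellCoveredIn : Subset n → Set
  WellCoveredIn W = ∀ S T → MaximalIndependentIn W S → MaximalIndependentIn W T → ∣ S ∣ ≡ ∣ T ∣

  WellCovered⇒WellCoveredIn-⊤ : WellCovered G → WellCoveredIn ⊤
  WellCovered⇒WellCoveredIn-⊤ wc S T S-max T-max = wc S T (global S-max) (global T-max)
    where
    global : ∀ {S} → MaximalIndependentIn ⊤ S → MaximalIndependent G S
    global ((_ , S-ind) , S-dom) = S-ind , λ v v∉S → S-dom v ∈⊤ v∉S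

  ∅-independent : ∀ W → IndependentIn W ∅
  ∅-independent W = (λ u∈∅ → ⊥-elim (∉⊥ u∈∅)) , (λ u v u∈∅ → ⊥-elim (∉⊥ u∈∅))

  ⁅⁆∪-independent : ∀ {W S v} → IndependentIn W S → v ∈ W → (∀ u → u ∈ S → adj G u v ≡ false) →
                    IndependentIn W (⁅ v ⁆ ∪ S)
  ⁅⁆∪-independent {W} {S} {v} (S⊆W , S-ind) v∈W v-free = ⊆W , ind
    where
    ⊆W : ⁅ v ⁆ ∪ S ⊆ W
    ⊆W u∈ with y∈⁅x⁆∪p⁻ u∈
    ... | inj₁ refl = v∈W
    ... | inj₂ u∈S  = S⊆W u∈S
    ind : ∀ u w → u ∈ ⁅ v ⁆ ∪ S → w ∈ ⁅ v ⁆ ∪ S → adj G u w ≡ false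
    ind u w u∈ w∈ with y∈⁅x⁆∪p⁻ u∈ | y∈⁅x⁆∪p⁻ w∈
    ... | inj₁ refl | inj₁ refl = irrefl G u
    ... | inj₁ refl | inj₂ w∈S  = nonadj-sym G (v-free w w∈S)
    ... | inj₂ u∈S  | inj₁ refl = v-free u u∈S
    ... | inj₂ u∈S  | inj₂ w∈S  = S-ind u w u∈S w∈S

  ⁅⁆∪-maximal : ∀ {X W U v} → MaximalIndependentIn X U → X ⊆ W → v ∈ W →
                (∀ u → u ∈ U → adj G u v ≡ false) →
                (∀ z → z ∈ W → z ∉ X → z ≢ v → adj G v z ≡ true) →
                MaximalIndependentIn W (⁅ v ⁆ ∪ U)
  ⁅⁆∪-maximal {X} {W} {U} {v} ((U⊆X , U-ind) , U-dom) X⊆W v∈W v-free rest-adj =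
    ⁅⁆∪-independent (X⊆W ∘ U⊆X , U-ind) v∈W v-free , dom
    where
    dom : DominatingIn W (⁅ v ⁆ ∪ U)
    dom z z∈W z∉ with z ∈? X
    ... | no z∉X = v , x∈⁅x⁆∪p v U , rest-adj z z∈W z∉X (λ { refl → z∉ (x∈⁅x⁆∪p v U) })
    ... | yes z∈X with U-dom z z∈X (z∉ ∘ q⊆p∪q ⁅ v ⁆ U)
    ...   | u , u∈U , uz = u , q⊆p∪q ⁅ v ⁆ U u∈U , uz

  private
    Addable : Subset n → Subset n → Fin n → Set
    Addable W S v = v ∈ W × v ∉ S × (∀ u → u ∈ S → adj G u v ≡ false)

    addable? : ∀ W S v → Dec (Addable W S v)
    addable? W S v = (v ∈? W) ×-dec ¬? (v ∈? S) ×-dec Fin.all? (λ u → (u ∈? S) →-dec (adj G u v Bool.≟ false))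

    saturated⇒dominating : ∀ {W S} → ¬ ∃ (Addable W S) → DominatingIn W S
    saturated⇒dominating {W} {S} saturated v v∈W v∉S
      with Fin.any? (λ u → (u ∈? S) ×-dec (adj G u v Bool.≟ true))
    ... | yes dominated = dominated
    ... | no undominated = ⊥-elim (saturated (v , v∈W , v∉S ,
            λ u u∈S → Bool.¬-not (λ uv → undominated (u , u∈S , uv))))

    extend : ∀ W k S → IndependentIn W S → n ℕ.≤ k ℕ.+ ∣ S ∣ → ∃ λ T → MaximalIndependentIn W T × S ⊆ T
    extend W k S S-ind n≤k+∣S∣ with Fin.any? (addable? W S)
    ... | no saturated = S , (S-ind , saturated⇒dominating saturated) , id
    ... | yes (v , v∈W , v∉S , v-free) with k
    ...   | zero = ⊥-elim (ℕ.<-irrefl refl (ℕ.<-≤-trans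
                     (ℕ.≤-trans (s≤s n≤k+∣S∣) (ℕ.≤-reflexive (sym (∣⁅x⁆∪p∣≡1+∣p∣ v∉S)))) (∣p∣≤n (⁅ v ⁆ ∪ S))))
    ...   | suc k with extend W k (⁅ v ⁆ ∪ S) (⁅⁆∪-independent S-ind v∈W v-free)
                         (ℕ.≤-trans n≤k+∣S∣ (ℕ.≤-reflexive (trans (sym (ℕ.+-suc k ∣ S ∣))
                                                                  (cong (k ℕ.+_) (sym (∣⁅x⁆∪p∣≡1+∣p∣ v∉S))))))
    ...     | T , T-max , ⁅v⁆∪S⊆T = T , T-max , ⁅v⁆∪S⊆T ∘ q⊆p∪q ⁅ v ⁆ S

  extend-to-maximal : ∀ W S → IndependentIn W S → ∃ λ T → MaximalIndependentIn W T × S ⊆ T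
  extend-to-maximal W S S-ind = extend W n S S-ind (ℕ.m≤m+n n ∣ S ∣)

  independent≤maximal : ∀ {W S T} → WellCoveredIn W → MaximalIndependentIn W S → IndependentIn W T →
                        ∣ T ∣ ℕ.≤ ∣ S ∣
  independent≤maximal {W} {S} {T} wc S-max T-ind with extend-to-maximal W T T-ind
  ... | T′ , T′-max , T⊆T′ = ℕ.≤-trans (p⊆q⇒∣p∣≤∣q∣ T⊆T′) (ℕ.≤-reflexive (wc T′ S T′-max S-max))

  ¬exchange-one-for-two : ∀ {W U v a b} → WellCoveredIn W → MaximalIndependentIn W (⁅ v ⁆ ∪ U) →
                          IndependentIn W (⁅ a ⁆ ∪ (⁅ b ⁆ ∪ U)) → v ∉ U → b ∉ U → a ∉ ⁅ b ⁆ ∪ U → ⊥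
  ¬exchange-one-for-two {U = U} {v} {a} {b} wc S-max T-ind v∉U b∉U a∉ =
    ℕ.<⇒≱ ∣S∣<∣T∣ (independent≤maximal wc S-max T-ind)
    where
    ∣S∣<∣T∣ : ∣ ⁅ v ⁆ ∪ U ∣ ℕ.< ∣ ⁅ a ⁆ ∪ (⁅ b ⁆ ∪ U) ∣
    ∣S∣<∣T∣ = subst₂ ℕ._<_ (sym (∣⁅x⁆∪p∣≡1+∣p∣ v∉U))
      (sym (trans (∣⁅x⁆∪p∣≡1+∣p∣ a∉) (cong suc (∣⁅x⁆∪p∣≡1+∣p∣ b∉U)))) (ℕ.n<1+n (suc ∣ U ∣))

  neighbours : Fin n → Subset n
  neighbours v = tabulate (adj G v)

  ∈-neighbours⁺ : ∀ {v u} → adj G v u ≡ true → u ∈ neighbours v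
  ∈-neighbours⁺ {v} {u} vu = lookup⇒[]= u (neighbours v) (trans (lookup∘tabulate (adj G v) u) vu)

  ∈-neighbours⁻ : ∀ {v u} → u ∈ neighbours v → adj G v u ≡ true
  ∈-neighbours⁻ {v} {u} u∈ = trans (sym (lookup∘tabulate (adj G v) u)) ([]=⇒lookup u∈)

  PendantIn : Subset n → Fin n → Fin n → Set
  PendantIn W l v = ∀ u → u ∈ W → adj G l u ≡ true → u ≡ v

  -- Exchange U + v for U + l + l′, with U maximal independent in W minus the closed neighbourhood of v.
  pendantIn-unique : ∀ {W v l l′} → WellCoveredIn W → v ∈ W → l ∈ W → l′ ∈ W →
                     adj G v l ≡ true → adj G v l′ ≡ true → PendantIn W l v → PendantIn W l′ v → l ≡ l′
  pendantIn-unique {W} {v} {l} {l′} wc v∈W l∈W l′∈W vl vl′ l-v l′-v with l Fin.≟ l′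
  ... | yes l≡l′ = l≡l′
  ... | no  l≢l′ = ⊥-elim (¬exchange-one-for-two wc U+v-max U+l+l′-ind v∉U (neighbour∉U vl) l′∉U+l)
    where
    X : Subset n
    X = W ─ (⁅ v ⁆ ∪ neighbours v)
    U : Subset n
    U = proj₁ (extend-to-maximal X ∅ (∅-independent X))
    U-max : MaximalIndependentIn X U
    U-max = proj₁ (proj₂ (extend-to-maximal X ∅ (∅-independent X)))
    U-outside : ∀ {u} → u ∈ U → u ∈ W × u ∉ ⁅ v ⁆ ∪ neighbours v
    U-outside u∈U = x∈p─q⁻ W _ (proj₁ (proj₁ U-max) u∈U)
    v∉U : v ∉ U
    v∉U v∈U = proj₂ (U-outside v∈U) (x∈⁅x⁆∪p v (neighbours v))
    neighbour∉U : ∀ {z} → adj G v z ≡ true → z ∉ U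
    neighbour∉U vz z∈U = proj₂ (U-outside z∈U) (q⊆p∪q ⁅ v ⁆ _ (∈-neighbours⁺ vz))
    pendant-free : ∀ {z} → PendantIn W z v → ∀ u → u ∈ U → adj G u z ≡ false
    pendant-free z-v u u∈U =
      nonadj-sym G (Bool.¬-not (λ zu → v∉U (subst (_∈ U) (z-v u (proj₁ (U-outside u∈U)) zu) u∈U)))

    U+v-max : MaximalIndependentIn W (⁅ v ⁆ ∪ U)
    U+v-max = ⁅⁆∪-maximal U-max (p─q⊆p W _) v∈W
      (λ u u∈U → nonadj-sym G (Bool.¬-not (λ vu → neighbour∉U vu u∈U))) v-adjacent
      where
      v-adjacent : ∀ z → z ∈ W → z ∉ X → z ≢ v → adj G v z ≡ true
      v-adjacent z z∈W z∉X z≢v with z ∈? neighbours v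
      ... | yes z∈N = ∈-neighbours⁻ z∈N
      ... | no  z∉N = ⊥-elim (z∉X (x∈p∧x∉q⇒x∈p─q z∈W (λ z∈ → [ z≢v , z∉N ]′ (y∈⁅x⁆∪p⁻ z∈))))

    U+l+l′-ind : IndependentIn W (⁅ l′ ⁆ ∪ (⁅ l ⁆ ∪ U))
    U+l+l′-ind = ⁅⁆∪-independent
      (⁅⁆∪-independent (proj₁ ∘ U-outside , proj₂ (proj₁ U-max)) l∈W (pendant-free l-v)) l′∈W l′-free
      where
      l′-free : ∀ u → u ∈ ⁅ l ⁆ ∪ U → adj G u l′ ≡ false
      l′-free u u∈ with y∈⁅x⁆∪p⁻ u∈
      ... | inj₁ refl = Bool.¬-not (λ ll′ → adj⇒≢ G vl′ (sym (l-v l′ l′∈W ll′)))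
      ... | inj₂ u∈U  = pendant-free l′-v u u∈U

    l′∉U+l : l′ ∉ ⁅ l ⁆ ∪ U
    l′∉U+l l′∈ = [ l≢l′ ∘ sym , neighbour∉U vl′ ]′ (y∈⁅x⁆∪p⁻ l′∈)

  Branching : Subset n → Fin n → Set
  Branching W v = ∃ λ a → ∃ λ b → a ∈ W × b ∈ W × adj G v a ≡ true × adj G v b ≡ true × a ≢ b

  Branching⇒another-neighbour : ∀ {W v} → Branching W v → ∀ l → ∃ λ c → c ∈ W × adj G v c ≡ true × c ≢ l
  Branching⇒another-neighbour (a , b , a∈W , b∈W , va , vb , a≢b) l with a Fin.≟ l
  ... | yes refl = b , b∈W , vb , a≢b ∘ sym
  ... | no  a≢l  = a , a∈W , va , a≢l

  CarriesPendantIn : Subset n → Fin n → Set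
  CarriesPendantIn W v = ∃ λ l → l ∈ W × adj G v l ≡ true × PendantIn W l v

  Corona : Subset n → Set
  Corona W = ∀ v → v ∈ W → Branching W v → CarriesPendantIn W v

  -- The shape of the end v₀ v₁ v₂ … of a longest path in a forest.
  record PendantPath (W : Subset n) : Set where
    field
      v₀ v₁ v₂      : Fin n
      v₀∈W          : v₀ ∈ W
      v₁∈W          : v₁ ∈ W
      v₀v₁          : adj G v₀ v₁ ≡ true
      v₀-pendant    : PendantIn W v₀ v₁
      v₁-neighbours : ∀ y → y ∈ W → adj G v₁ y ≡ true → y ≡ v₀ ⊎ y ≡ v₂ ⊎ PendantIn W y v₁

  Consecutive : ∀ len → (Fin (suc len) → Fin n) → Set
  Consecutive len f = ∀ (i : Fin len) → adj G (f (inject₁ i)) (f (suc i)) ≡ true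

  -- The decision is an argument so that the recursion on len is structural.
  private
    closing-edge⇒cycle′ : ∀ len (f : Fin (suc len) → Fin n) → Injective _≡_ _≡_ f → Consecutive len f →
                          ∀ j → 2 ℕ.≤ toℕ j → adj G (f j) (f zero) ≡ true → Dec (len ≡ toℕ j) → HasCycle G
    closing-edge⇒cycle′ zero          f _     _      zero       ()       _     _
    closing-edge⇒cycle′ (suc zero)    f _     _      zero       ()       _     _
    closing-edge⇒cycle′ (suc zero)    f _     _      (suc zero) (s≤s ()) _     _
    closing-edge⇒cycle′ (suc (suc k)) f f-inj f-cons j 2≤j fj-f₀ (yes len≡j) =
      k , f , (λ {x} {y} → f-inj) , f-cons ,
      subst (λ i → adj G (f i) (f zero) ≡ true)
            (Fin.toℕ-injective (trans (sym len≡j) (sym (Fin.toℕ-fromℕ (suc (suc k)))))) fj-f₀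
    closing-edge⇒cycle′ (suc (suc k)) f f-inj f-cons j 2≤j fj-f₀ (no len≢j) =
      closing-edge⇒cycle′ (suc k) (f ∘ inject₁) (Fin.inject₁-injective ∘ f-inj) (f-cons ∘ inject₁) j′
        (subst (2 ℕ.≤_) (sym (Fin.toℕ-lower₁ j len≢j)) 2≤j)
        (subst (λ i → adj G (f i) (f zero) ≡ true) (sym (Fin.inject₁-lower₁ j len≢j)) fj-f₀)
        (suc k ℕ.≟ toℕ j′)
      where
      j′ : Fin (suc (suc k))
      j′ = lower₁ j len≢j

  closing-edge⇒cycle : ∀ len (f : Fin (suc len) → Fin n) → Injective _≡_ _≡_ f → Consecutive len f →
                       ∀ j → 2 ℕ.≤ toℕ j → adj G (f j) (f zero) ≡ true → HasCycle G
  closing-edge⇒cycle len f f-inj f-cons j 2≤j fj-f₀ =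
    closing-edge⇒cycle′ len f f-inj f-cons j 2≤j fj-f₀ (len ℕ.≟ toℕ j)

  ∷-consecutive : ∀ {m u} {f : Fin (suc m) → Fin n} → adj G u (f zero) ≡ true → Consecutive m f →
                  Consecutive (suc m) (u Vector.∷ f)
  ∷-consecutive u-f₀ f-cons zero    = u-f₀
  ∷-consecutive u-f₀ f-cons (suc i) = f-cons i

  module LongestPath (forest : Forest G) (W : Subset n) where

    record Path : Set where
      constructor path
      field
        k           : ℕ
        f           : Fin (suc (suc k)) → Fin n
        injective   : Injective _≡_ _≡_ f
        within      : ∀ i → f i ∈ W
        consecutive : Consecutive (suc k) f

    OnPath : Path → Fin n → Set
    OnPath P u = ∃ λ i → Path.f P i ≡ u

    onPath? : ∀ P u → Dec (OnPath P u)
    onPath? P u = Fin.any? (λ i → Path.f P i Fin.≟ u)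

    Prependable : Path → Set
    Prependable P = ∃ λ u → u ∈ W × adj G (Path.f P zero) u ≡ true × ¬ OnPath P u

    -- Then w u f₁ f₂ … is a longer path.
    Rerouteable : Path → Set
    Rerouteable P = ∃ λ u → ∃ λ w → u ∈ W × w ∈ W × adj G (Path.f P (suc zero)) u ≡ true ×
                      adj G u w ≡ true × ¬ OnPath P u × ¬ OnPath P w

    prependable? : ∀ P → Dec (Prependable P)
    prependable? P = Fin.any? λ u → (u ∈? W) ×-dec (adj G (Path.f P zero) u Bool.≟ true) ×-dec ¬? (onPath? P u)

    rerouteable? : ∀ P → Dec (Rerouteable P)
    rerouteable? P = Fin.any? λ u → Fin.any? λ w → (u ∈? W) ×-dec (w ∈? W)
      ×-dec (adj G (Path.f P (suc zero)) u Bool.≟ true) ×-dec (adj G u w Bool.≟ true)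
      ×-dec ¬? (onPath? P u) ×-dec ¬? (onPath? P w)

    ∷-inside : ∀ {m u} {f : Fin m → Fin n} → u ∈ W → (∀ i → f i ∈ W) → ∀ i → (u Vector.∷ f) i ∈ W
    ∷-inside u∈W f∈W zero    = u∈W
    ∷-inside u∈W f∈W (suc i) = f∈W i

    prepend : ∀ P → Prependable P → Path
    prepend (path k f f-inj f∈W f-cons) (u , u∈W , f₀u , u∉f) =
      path (suc k) (u Vector.∷ f) (∷-injective (λ i → u∉f ∘ (i ,_)) f-inj) (∷-inside u∈W f∈W)
           (∷-consecutive (adj-sym G f₀u) f-cons)

    reroute : ∀ P → Rerouteable P → Path
    reroute (path k f f-inj f∈W f-cons) (u , w , u∈W , w∈W , f₁u , uw , u∉f , w∉f) =
      path (suc k) (w Vector.∷ (u Vector.∷ Vector.tail f))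
           (∷-injective w∉ (∷-injective (λ i → u∉f ∘ (suc i ,_)) (tail-injective f-inj)))
           (∷-inside w∈W (∷-inside u∈W (f∈W ∘ suc)))
           (∷-consecutive (adj-sym G uw) (∷-consecutive (adj-sym G f₁u) (f-cons ∘ suc)))
      where
      w∉ : ∀ i → (u Vector.∷ Vector.tail f) i ≢ w
      w∉ zero    = adj⇒≢ G uw
      w∉ (suc i) = w∉f ∘ (suc i ,_)

    private
      v₂-of : Path → Fin n
      v₂-of (path zero    f _ _ _) = f zero
      v₂-of (path (suc k) f _ _ _) = f (suc (suc zero))

      on-path : ∀ P i → let f = Path.f P in adj G (f (suc zero)) (f i) ≡ true →
                f i ≡ f zero ⊎ f i ≡ v₂-of P ⊎ PendantIn W (f i) (f (suc zero))
      on-path P                      zero                f₁fᵢ = inj₁ refl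
      on-path P                      (suc zero)          f₁fᵢ = ⊥-elim (adj⇒≢ G f₁fᵢ refl)
      on-path (path (suc k) f _ _ _) (suc (suc zero))    f₁fᵢ = inj₂ (inj₁ refl)
      on-path (path (suc k) f f-inj _ f-cons) (suc (suc (suc i))) f₁fᵢ =
        ⊥-elim (forest (closing-edge⇒cycle (suc k) (Vector.tail f) (tail-injective f-inj)
                         (f-cons ∘ suc) (suc (suc i)) (s≤s (s≤s z≤n)) (adj-sym G f₁fᵢ)))

    finish : ∀ P → ¬ Prependable P → ¬ Rerouteable P → PendantPath W
    finish P@(path k f f-inj f∈W f-cons) ¬prependable ¬rerouteable = record
      { v₀ = f zero ; v₁ = f (suc zero) ; v₂ = v₂-of P
      ; v₀∈W = f∈W zero ; v₁∈W = f∈W (suc zero) ; v₀v₁ = f-cons zero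
      ; v₀-pendant = v₀-pendant ; v₁-neighbours = v₁-neighbours }
      where
      cycle-from : ∀ i → adj G (f zero) (f (suc (suc i))) ≡ true → HasCycle G
      cycle-from i f₀fᵢ =
        closing-edge⇒cycle (suc k) f f-inj f-cons (suc (suc i)) (s≤s (s≤s z≤n)) (adj-sym G f₀fᵢ)

      v₀-pendant : PendantIn W (f zero) (f (suc zero))
      v₀-pendant u u∈W f₀u with onPath? P u
      ... | no u∉f                   = ⊥-elim (¬prependable (u , u∈W , f₀u , u∉f))
      ... | yes (zero , refl)        = ⊥-elim (adj⇒≢ G f₀u refl)
      ... | yes (suc zero , refl)    = refl
      ... | yes (suc (suc i) , refl) = ⊥-elim (forest (cycle-from i f₀u))

      off-path : ∀ y → y ∈ W → adj G (f (suc zero)) y ≡ true → ¬ OnPath P y → PendantIn W y (f (suc zero))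
      off-path y y∈W f₁y y∉f z z∈W yz with onPath? P z
      ... | no z∉f                   = ⊥-elim (¬rerouteable (y , z , y∈W , z∈W , f₁y , yz , y∉f , z∉f))
      ... | yes (zero , refl)        = ⊥-elim (¬prependable (y , y∈W , adj-sym G yz , y∉f))
      ... | yes (suc zero , refl)    = refl
      ... | yes (suc (suc i) , refl) = ⊥-elim (forest (closing-edge⇒cycle (suc k) (y Vector.∷ Vector.tail f)
              (∷-injective (λ j → y∉f ∘ (suc j ,_)) (tail-injective f-inj))
              (∷-consecutive (adj-sym G f₁y) (f-cons ∘ suc))
              (suc (suc i)) (s≤s (s≤s z≤n)) (adj-sym G yz)))

      v₁-neighbours : ∀ y → y ∈ W → adj G (f (suc zero)) y ≡ true →
                      y ≡ f zero ⊎ y ≡ v₂-of P ⊎ PendantIn W y (f (suc zero))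
      v₁-neighbours y y∈W f₁y with onPath? P y
      ... | yes (i , refl) = on-path P i f₁y
      ... | no  y∉f        = inj₂ (inj₂ (off-path y y∈W f₁y y∉f))

    private
      extend-or-finish : ∀ P → (∃ λ P′ → Path.k P′ ≡ suc (Path.k P)) ⊎ PendantPath W
      extend-or-finish P with prependable? P | rerouteable? P
      ... | yes p  | _      = inj₁ (prepend P p , refl)
      ... | no _   | yes r  = inj₁ (reroute P r , refl)
      ... | no ¬p  | no ¬r  = inj₂ (finish P ¬p ¬r)

      length≤n : ∀ P → suc (suc (Path.k P)) ℕ.≤ n
      length≤n P = Fin.injective⇒≤ (Path.injective P)

      search : ∀ fuel P → n ℕ.≤ fuel ℕ.+ suc (suc (Path.k P)) → PendantPath W
      search fuel P n≤ with extend-or-finish P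
      ... | inj₂ done = done
      ... | inj₁ (P′ , k′≡1+k) with fuel
      ...   | zero       = ⊥-elim (ℕ.<-irrefl refl (ℕ.<-≤-trans (s≤s n≤)
                             (subst (λ k′ → suc (suc k′) ℕ.≤ n) k′≡1+k (length≤n P′))))
      ...   | suc fuel′  = search fuel′ P′ (subst (λ k′ → n ℕ.≤ fuel′ ℕ.+ suc (suc k′)) (sym k′≡1+k)
                             (subst (n ℕ.≤_) (sym (ℕ.+-suc fuel′ _)) n≤))

    edge⇒pendantPath : ∀ {a b} → a ∈ W → b ∈ W → adj G a b ≡ true → PendantPath W
    edge⇒pendantPath {a} {b} a∈W b∈W ab = search n edge (ℕ.m≤m+n n 2)
      where
      edge : Path
      edge = path zero (a Vector.∷ (b Vector.∷ Vector.[]))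
        (∷-injective (λ { zero → adj⇒≢ G ab ∘ sym ; (suc ()) }) (∷-injective (λ ()) (λ { {()} })))
        (∷-inside a∈W (∷-inside b∈W (λ ())))
        (∷-consecutive ab (λ ()))

  module RemovePendantEdge {W : Subset n} (wc : WellCoveredIn W) (P : PendantPath W) where
    open PendantPath P

    W′ : Subset n
    W′ = W ∖ v₀ ∖ v₁

    ∈W′⁺ : ∀ {u} → u ∈ W → u ≢ v₀ → u ≢ v₁ → u ∈ W′
    ∈W′⁺ u∈W u≢v₀ u≢v₁ = x∈p∧x≢y⇒x∈p-y (x∈p∧x≢y⇒x∈p-y u∈W u≢v₀) u≢v₁

    ∈W′⁻ : ∀ {u} → u ∈ W′ → u ∈ W × u ≢ v₀ × u ≢ v₁
    ∈W′⁻ u∈W′ with x∈p∖y⁻ u∈W′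
    ... | u∈W∖v₀ , u≢v₁ with x∈p∖y⁻ u∈W∖v₀
    ...   | u∈W , u≢v₀ = u∈W , u≢v₀ , u≢v₁

    ∣W′∣<∣W∣ : ∣ W′ ∣ ℕ.< ∣ W ∣
    ∣W′∣<∣W∣ = ℕ.<-trans (x∈p⇒∣p-x∣<∣p∣ (x∈p∧x≢y⇒x∈p-y v₁∈W (adj⇒≢ G v₀v₁ ∘ sym))) (x∈p⇒∣p-x∣<∣p∣ v₀∈W)

    v₀-only : ∀ u → u ∈ W → adj G u v₀ ≡ true → u ≡ v₁
    v₀-only u u∈W uv₀ = v₀-pendant u u∈W (adj-sym G uv₀)

    v₁-neighbours′ : ∀ y → y ∈ W → adj G v₁ y ≡ true → y ≡ v₀ ⊎ y ≡ v₂
    v₁-neighbours′ y y∈W v₁y with v₁-neighbours y y∈W v₁y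
    ... | inj₁ y≡v₀          = inj₁ y≡v₀
    ... | inj₂ (inj₁ y≡v₂)   = inj₂ y≡v₂
    ... | inj₂ (inj₂ y-v₁)   = inj₁ (pendantIn-unique wc v₁∈W y∈W v₀∈W v₁y (adj-sym G v₀v₁) y-v₁ v₀-pendant)

    ⁅v₀⁆∪-maximal : ∀ {S} → MaximalIndependentIn W′ S → MaximalIndependentIn W (⁅ v₀ ⁆ ∪ S)
    ⁅v₀⁆∪-maximal S-max = ⁅⁆∪-maximal S-max (proj₁ ∘ ∈W′⁻) v₀∈W
      (λ u u∈S → Bool.¬-not (λ uv₀ → let u∈W , _ , u≢v₁ = ∈W′⁻ (proj₁ (proj₁ S-max) u∈S) in
                                      u≢v₁ (v₀-only u u∈W uv₀)))
      (λ z z∈W z∉W′ z≢v₀ → subst (λ z → adj G v₀ z ≡ true) (sym (v₁-removed z∈W z∉W′ z≢v₀)) v₀v₁)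
      where
      v₁-removed : ∀ {z} → z ∈ W → z ∉ W′ → z ≢ v₀ → z ≡ v₁
      v₁-removed {z} z∈W z∉W′ z≢v₀ with z Fin.≟ v₁
      ... | yes z≡v₁ = z≡v₁
      ... | no  z≢v₁ = ⊥-elim (z∉W′ (∈W′⁺ z∈W z≢v₀ z≢v₁))

    W′-wellCovered : WellCoveredIn W′
    W′-wellCovered S T S-max T-max = ℕ.suc-injective (begin
      suc ∣ S ∣           ≡⟨ sym (∣⁅x⁆∪p∣≡1+∣p∣ (v₀∉ S-max)) ⟩
      ∣ ⁅ v₀ ⁆ ∪ S ∣      ≡⟨ wc _ _ (⁅v₀⁆∪-maximal S-max) (⁅v₀⁆∪-maximal T-max) ⟩
      ∣ ⁅ v₀ ⁆ ∪ T ∣      ≡⟨ ∣⁅x⁆∪p∣≡1+∣p∣ (v₀∉ T-max) ⟩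
      suc ∣ T ∣           ∎)
      where
      open ≡-Reasoning
      v₀∉ : ∀ {S} → MaximalIndependentIn W′ S → v₀ ∉ S
      v₀∉ S-max v₀∈S = proj₁ (proj₂ (∈W′⁻ (proj₁ (proj₁ S-max) v₀∈S))) refl

    -- Exchange U + v₁ for U + v₂ + v₀, with U maximal independent in W′ ∖ v₂ and containing u.
    mate-pendant : adj G v₁ v₂ ≡ true → v₂ ∈ W → ∀ {w} → w ∈ W′ → adj G v₂ w ≡ true →
                   PendantIn W′ v₂ w → PendantIn W′ w v₂
    mate-pendant v₁v₂ v₂∈W {w} w∈W′ v₂w v₂-w u u∈W′ wu with u Fin.≟ v₂
    ... | yes u≡v₂ = u≡v₂
    ... | no  u≢v₂ = ⊥-elim (¬exchange-one-for-two wc U+v₁-max U+v₂+v₀-ind v₁∉U v₂∉U v₀∉U+v₂)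
      where
      W″ : Subset n
      W″ = W′ ∖ v₂
      ∈W″⁻ : ∀ {z} → z ∈ W″ → z ∈ W × z ≢ v₀ × z ≢ v₁ × z ≢ v₂
      ∈W″⁻ z∈W″ with x∈p∖y⁻ z∈W″
      ... | z∈W′ , z≢v₂ = let z∈W , z≢v₀ , z≢v₁ = ∈W′⁻ z∈W′ in z∈W , z≢v₀ , z≢v₁ , z≢v₂
      u-ind : IndependentIn W″ (⁅ u ⁆ ∪ ∅)
      u-ind = ⁅⁆∪-independent (∅-independent W″) (x∈p∧x≢y⇒x∈p-y u∈W′ u≢v₂) (λ z z∈∅ → ⊥-elim (∉⊥ z∈∅))
      U : Subset n
      U = proj₁ (extend-to-maximal W″ (⁅ u ⁆ ∪ ∅) u-ind)
      U-max : MaximalIndependentIn W″ U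
      U-max = proj₁ (proj₂ (extend-to-maximal W″ (⁅ u ⁆ ∪ ∅) u-ind))
      u∈U : u ∈ U
      u∈U = proj₂ (proj₂ (extend-to-maximal W″ (⁅ u ⁆ ∪ ∅) u-ind)) (x∈⁅x⁆∪p u ∅)
      U⊆W″ : U ⊆ W″
      U⊆W″ = proj₁ (proj₁ U-max)
      w∉U : w ∉ U
      w∉U w∈U with trans (sym (proj₂ (proj₁ U-max) w u w∈U u∈U)) wu
      ... | ()
      v₀∉U : v₀ ∉ U
      v₀∉U v₀∈U = proj₁ (proj₂ (∈W″⁻ (U⊆W″ v₀∈U))) refl
      v₁∉U : v₁ ∉ U
      v₁∉U v₁∈U = proj₁ (proj₂ (proj₂ (∈W″⁻ (U⊆W″ v₁∈U)))) refl
      v₂∉U : v₂ ∉ U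
      v₂∉U v₂∈U = proj₂ (proj₂ (proj₂ (∈W″⁻ (U⊆W″ v₂∈U)))) refl
      U⊆W : U ⊆ W
      U⊆W = proj₁ ∘ ∈W″⁻ ∘ U⊆W″

      U+v₁-max : MaximalIndependentIn W (⁅ v₁ ⁆ ∪ U)
      U+v₁-max = ⁅⁆∪-maximal U-max (proj₁ ∘ ∈W″⁻) v₁∈W v₁-free v₁-adjacent
        where
        v₁-free : ∀ z → z ∈ U → adj G z v₁ ≡ false
        v₁-free z z∈U = Bool.¬-not λ zv₁ →
          [ (λ { refl → v₀∉U z∈U }) , (λ { refl → v₂∉U z∈U }) ]′ (v₁-neighbours′ z (U⊆W z∈U) (adj-sym G zv₁))
        v₁-adjacent : ∀ z → z ∈ W → z ∉ W″ → z ≢ v₁ → adj G v₁ z ≡ true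
        v₁-adjacent z z∈W z∉W″ z≢v₁ with z Fin.≟ v₀ | z Fin.≟ v₂
        ... | yes refl | _        = adj-sym G v₀v₁
        ... | no  _    | yes refl = v₁v₂
        ... | no z≢v₀  | no z≢v₂  = ⊥-elim (z∉W″ (x∈p∧x≢y⇒x∈p-y (∈W′⁺ z∈W z≢v₀ z≢v₁) z≢v₂))

      U+v₂+v₀-ind : IndependentIn W (⁅ v₀ ⁆ ∪ (⁅ v₂ ⁆ ∪ U))
      U+v₂+v₀-ind = ⁅⁆∪-independent (⁅⁆∪-independent (U⊆W , proj₂ (proj₁ U-max)) v₂∈W v₂-free) v₀∈W v₀-free
        where
        v₂-free : ∀ z → z ∈ U → adj G z v₂ ≡ false
        v₂-free z z∈U = Bool.¬-not λ zv₂ →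
          w∉U (subst (_∈ U) (v₂-w z (proj₁ (x∈p∖y⁻ (U⊆W″ z∈U))) (adj-sym G zv₂)) z∈U)
        v₀-free : ∀ z → z ∈ ⁅ v₂ ⁆ ∪ U → adj G z v₀ ≡ false
        v₀-free z z∈ = Bool.¬-not λ zv₀ →
          [ (λ { refl → adj⇒≢ G v₁v₂ (sym (v₀-only z v₂∈W zv₀)) })
          , (λ z∈U → v₁∉U (subst (_∈ U) (v₀-only z (U⊆W z∈U) zv₀) z∈U)) ]′ (y∈⁅x⁆∪p⁻ z∈)

      v₀∉U+v₂ : v₀ ∉ ⁅ v₂ ⁆ ∪ U
      v₀∉U+v₂ v₀∈ with y∈⁅x⁆∪p⁻ v₀∈
      ... | inj₁ refl = proj₂ (proj₂ (∈W′⁻ w∈W′)) (v₀-only w (proj₁ (∈W′⁻ w∈W′)) (adj-sym G v₂w))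
      ... | inj₂ v₀∈U = v₀∉U v₀∈U

    pendant-lifts : ∀ {l x} → l ∈ W′ → adj G v₁ l ≢ true → PendantIn W′ l x → PendantIn W l x
    pendant-lifts {l} l∈W′ ¬v₁l l-x u u∈W lu with u Fin.≟ v₀ | u Fin.≟ v₁
    ... | yes refl | _        = ⊥-elim (proj₂ (proj₂ (∈W′⁻ l∈W′)) (v₀-only l (proj₁ (∈W′⁻ l∈W′)) lu))
    ... | no  _    | yes refl = ⊥-elim (¬v₁l (adj-sym G lu))
    ... | no u≢v₀  | no u≢v₁  = l-x u (∈W′⁺ u∈W u≢v₀ u≢v₁) lu

    ¬v₁-adjacent : ∀ {l} → l ∈ W′ → l ≢ v₂ → adj G v₁ l ≢ true
    ¬v₁-adjacent l∈W′ l≢v₂ v₁l with v₁-neighbours′ _ (proj₁ (∈W′⁻ l∈W′)) v₁l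
    ... | inj₁ l≡v₀ = proj₁ (proj₂ (∈W′⁻ l∈W′)) l≡v₀
    ... | inj₂ l≡v₂ = l≢v₂ l≡v₂

    carries-lifts : ∀ {v l} → l ∈ W′ → adj G v₁ l ≢ true → adj G v l ≡ true → PendantIn W′ l v →
                    CarriesPendantIn W v
    carries-lifts l∈W′ ¬v₁l vl l-v = _ , proj₁ (∈W′⁻ l∈W′) , vl , pendant-lifts l∈W′ ¬v₁l l-v

    neighbour∈W′ : ∀ {v c} → v ∈ W → v ≢ v₁ → adj G v₁ v ≢ true → c ∈ W → adj G v c ≡ true → c ∈ W′
    neighbour∈W′ {v} v∈W v≢v₁ ¬v₁v c∈W vc =
      ∈W′⁺ c∈W (λ { refl → v≢v₁ (v₀-only v v∈W vc) }) (λ { refl → ¬v₁v (adj-sym G vc) })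

    module _ (IH : Corona W′) where

      v₂-carries : adj G v₁ v₂ ≡ true → v₂ ∈ W → v₂ ≢ v₀ → v₂ ≢ v₁ → CarriesPendantIn W v₂
      v₂-carries v₁v₂ v₂∈W v₂≢v₀ v₂≢v₁ with Fin.any? (λ w → (w ∈? W′) ×-dec (adj G v₂ w Bool.≟ true))
      ... | no none =
        ⊥-elim (v₂≢v₀ (sym (pendantIn-unique wc v₁∈W v₀∈W v₂∈W (adj-sym G v₀v₁) v₁v₂ v₀-pendant v₂-v₁)))
        where
        v₂-v₁ : PendantIn W v₂ v₁
        v₂-v₁ u u∈W v₂u with u Fin.≟ v₀ | u Fin.≟ v₁
        ... | yes refl | _        = ⊥-elim (v₂≢v₁ (v₀-only v₂ v₂∈W v₂u))
        ... | no  _    | yes u≡v₁ = u≡v₁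
        ... | no u≢v₀  | no u≢v₁  = ⊥-elim (none (u , ∈W′⁺ u∈W u≢v₀ u≢v₁ , v₂u))
      ... | yes (w , w∈W′ , v₂w)
        with Fin.any? (λ w′ → (w′ ∈? W′) ×-dec (adj G v₂ w′ Bool.≟ true) ×-dec ¬? (w′ Fin.≟ w))
      ...   | yes (w′ , w′∈W′ , v₂w′ , w′≢w)
        with IH v₂ (∈W′⁺ v₂∈W v₂≢v₀ v₂≢v₁) (w′ , w , w′∈W′ , w∈W′ , v₂w′ , v₂w , w′≢w)
      ...     | l , l∈W′ , v₂l , l-v₂ = carries-lifts l∈W′ (¬v₁-adjacent l∈W′ (adj⇒≢ G v₂l ∘ sym)) v₂l l-v₂
      v₂-carries v₁v₂ v₂∈W v₂≢v₀ v₂≢v₁ | yes (w , w∈W′ , v₂w) | no single =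
        carries-lifts w∈W′ (¬v₁-adjacent w∈W′ (adj⇒≢ G v₂w ∘ sym)) v₂w (mate-pendant v₁v₂ v₂∈W w∈W′ v₂w v₂-w)
        where
        v₂-w : PendantIn W′ v₂ w
        v₂-w y y∈W′ v₂y with y Fin.≟ w
        ... | yes y≡w = y≡w
        ... | no  y≢w = ⊥-elim (single (y , y∈W′ , v₂y , y≢w))

      far-carries : ∀ {v} → v ∈ W → Branching W v → v ≢ v₀ → v ≢ v₁ → adj G v₁ v ≢ true →
                    CarriesPendantIn W v
      far-carries {v} v∈W v-branching@(a , b , a∈W , b∈W , va , vb , a≢b) v≢v₀ v≢v₁ ¬v₁v
        with IH v (∈W′⁺ v∈W v≢v₀ v≢v₁) (a , b , nb a∈W va , nb b∈W vb , va , vb , a≢b)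
        where
        nb : ∀ {c} → c ∈ W → adj G v c ≡ true → c ∈ W′
        nb = neighbour∈W′ v∈W v≢v₁ ¬v₁v
      ... | l , l∈W′ , vl , l-v with adj G v₁ l Bool.≟ true
      ...   | no ¬v₁l = carries-lifts l∈W′ ¬v₁l vl l-v
      ...   | yes v₁l with v₁-neighbours′ l (proj₁ (∈W′⁻ l∈W′)) v₁l | Branching⇒another-neighbour v-branching l
      ...     | inj₁ refl | _                   = ⊥-elim (proj₁ (proj₂ (∈W′⁻ l∈W′)) refl)
      ...     | inj₂ refl | c , c∈W , vc , c≢v₂ =
        ⊥-elim (c≢v₂ (mate-pendant v₁l (proj₁ (∈W′⁻ l∈W′)) (∈W′⁺ v∈W v≢v₀ v≢v₁) (adj-sym G vl) l-v
                                   c (neighbour∈W′ v∈W v≢v₁ ¬v₁v c∈W vc) vc))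

      corona : Corona W
      corona v v∈W v-branching with v Fin.≟ v₀ | v Fin.≟ v₁
      corona v v∈W (a , b , a∈W , b∈W , va , vb , a≢b) | yes refl | _ =
        ⊥-elim (a≢b (trans (v₀-pendant a a∈W va) (sym (v₀-pendant b b∈W vb))))
      ... | no _     | yes refl = v₀ , v₀∈W , adj-sym G v₀v₁ , v₀-pendant
      ... | no v≢v₀  | no v≢v₁ with adj G v₁ v Bool.≟ true
      ...   | no ¬v₁v = far-carries v∈W v-branching v≢v₀ v≢v₁ ¬v₁v
      ...   | yes v₁v with v₁-neighbours′ v v∈W v₁v
      ...     | inj₁ v≡v₀ = ⊥-elim (v≢v₀ v≡v₀)
      ...     | inj₂ refl = v₂-carries v₁v v∈W v≢v₀ v≢v₁

  forest⇒wellCoveredIn⇒corona : Forest G → ∀ W → WellCoveredIn W → Corona W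
  forest⇒wellCoveredIn⇒corona forest =
    All.wfRec (On.wellFounded ∣_∣ ℕ.<-wellFounded) _ (λ W → WellCoveredIn W → Corona W) step
    where
    step : ∀ W → (∀ {W′} → ∣ W′ ∣ ℕ.< ∣ W ∣ → WellCoveredIn W′ → Corona W′) → WellCoveredIn W → Corona W
    step W IH wc with Fin.any? (λ a → Fin.any? λ b → (a ∈? W) ×-dec (b ∈? W) ×-dec (adj G a b Bool.≟ true))
    ... | no no-edge = λ { v v∈W (a , _ , a∈W , _ , va , _) → ⊥-elim (no-edge (v , a , v∈W , a∈W , va)) }
    ... | yes (a , b , a∈W , b∈W , ab) = corona (IH ∣W′∣<∣W∣ W′-wellCovered)
      where open RemovePendantEdge wc (LongestPath.edge⇒pendantPath forest W a∈W b∈W ab)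

  ¬isolated⇒neighbour : ∀ {v} → ¬ Isolated G v → ∃ λ a → adj G v a ≡ true
  ¬isolated⇒neighbour {v} ¬iso with Fin.any? (λ a → adj G v a Bool.≟ true)
  ... | yes neighbour  = neighbour
  ... | no ¬neighbour = ⊥-elim (¬iso (λ u → Bool.¬-not (λ vu → ¬neighbour (u , vu))))

  ¬leaf⇒branching : ∀ {v a} → ¬ Leaf G v → adj G v a ≡ true → Branching ⊤ v
  ¬leaf⇒branching {v} {a} ¬leaf va with Fin.any? (λ b → (adj G v b Bool.≟ true) ×-dec ¬? (b Fin.≟ a))
  ... | yes (b , vb , b≢a) = b , a , ∈⊤ , ∈⊤ , vb , va , b≢a
  ... | no ¬other = ⊥-elim (¬leaf (a , va , only-a))
    where
    only-a : ∀ u → adj G v u ≡ true → u ≡ a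
    only-a u vu = decidable-stable (u Fin.≟ a) (λ u≢a → ¬other (u , vu , u≢a))

  leaf⇒pendantIn-⊤ : ∀ {l v} → adj G l v ≡ true → Leaf G l → PendantIn ⊤ l v
  leaf⇒pendantIn-⊤ {l} {v} lv (a , _ , only-a) u _ lu = trans (only-a u lu) (sym (only-a v lv))

  wellCovered-forest⇒pendantMatching : Forest G → WellCovered G → PendantMatching G
  wellCovered-forest⇒pendantMatching forest wc = matching
    where
    wc⊤ : WellCoveredIn ⊤
    wc⊤ = WellCovered⇒WellCoveredIn-⊤ wc

    matching : PendantMatching G
    matching v ¬iso with leaf? G v
    ... | yes (a , va , only-a) = a , (va , inj₁ (a , va , only-a)) , λ w (vw , _) → only-a w vw
    ... | no ¬leaf with ¬isolated⇒neighbour ¬iso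
    ...   | a , va with forest⇒wellCoveredIn⇒corona forest ⊤ wc⊤ v ∈⊤ (¬leaf⇒branching ¬leaf va)
    ...     | l , _ , vl , l-v = l , (vl , inj₂ l-leaf) , unique
      where
      l-leaf : Leaf G l
      l-leaf = v , adj-sym G vl , λ u lu → l-v u ∈⊤ lu
      unique : ∀ w → PendantEdge G v w → w ≡ l
      unique w (vw , inj₁ v-leaf) = ⊥-elim (¬leaf v-leaf)
      unique w (vw , inj₂ w-leaf) = pendantIn-unique wc⊤ ∈⊤ ∈⊤ ∈⊤ vw vl
        (leaf⇒pendantIn-⊤ (adj-sym G vw) w-leaf) (leaf⇒pendantIn-⊤ (adj-sym G vl) l-leaf)

theorem6 : (n : ℕ) (G : Graph n) → Forest G →
    ((WellCovered G → ConstantOnSOL G) × (ConstantOnSOL G → WellCovered G))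
    × (WellCovered G → NoIsolatedVertices G →
         (x : Fin n → ℚ) → SOL G x → eᵀ x ≡ (+ n) / 2)
theorem6 n G forest = (constant , constantOnSOL⇒wellCovered G) , half
  where
  double-sum : WellCovered G → ∀ {x} → SOL G x → eᵀ x + eᵀ x ≡ fromℕ n + Σℚ (λ v → 𝟙 (isolated? G v))
  double-sum wc = SOL-double-sum G (wellCovered-forest⇒pendantMatching G forest wc)

  constant : WellCovered G → ConstantOnSOL G
  constant wc x y x∈SOL y∈SOL = p+p≡q+q⇒p≡q (trans (double-sum wc x∈SOL) (sym (double-sum wc y∈SOL)))

  half : WellCovered G → NoIsolatedVertices G → (x : Fin n → ℚ) → SOL G x → eᵀ x ≡ (+ n) / 2
  half wc no-isolated x x∈SOL = p+p≡q+q⇒p≡q (begin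
    eᵀ x + eᵀ x                             ≡⟨ double-sum wc x∈SOL ⟩
    fromℕ n + Σℚ (λ v → 𝟙 (isolated? G v))  ≡⟨ cong (_+_ (fromℕ n)) (Σℚ-isolated≡0 G no-isolated) ⟩
    fromℕ n + 0ℚ                            ≡⟨ ℚ.+-identityʳ (fromℕ n) ⟩
    fromℕ n                                 ≡⟨ sym (m/2+m/2≡fromℕ n) ⟩
    (+ n) / 2 + (+ n) / 2                   ∎)
    where open ≡-Reasoning
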